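{- Let $T(n)=\sum_{k=0}^{n}\left[\binom{n+7k}{3n+k}\binom{n}{k}\bmod 2\right]$ for $n\ge 0$. Let $(S(n))_{n\ge0}$ be defined by $S(0)=1$, $S(1)=0$, $S(2)=1$ and $S(n)=S(n-2)+S(n-3)$ for $n\ge 3$ (the Padovan numbers, OEIS A000931, starting at offset $3$: $1,0,1,1,1,2,2,3,\dots$). Then $T$ is the run length transform of $S$.
   Context: For integers $a$ and $b\ge0$, $\binom{a}{b}=0$ whenever $a<b$. $[x \bmod 2]$ denotes the residue in $\{0,1\}$. The run length transform of a sequence $(S(n))_{n\ge0}$ is $T(n)=\prod_{i\in\mathcal{L}(n)}S(i)$, where $\mathcal{L}(n)$ is the multiset of lengths of all maximal runs of $1$'s in the binary representation of $n$ (so $T(0)=1$). -}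

module Defs where

open import Data.Nat using (ℕ; zero; suc; _+_; _*_; _%_; _/_)
open import Data.Nat.Combinatorics using (_C_)
open import Data.List using (List; []; _∷_; map; upTo)
open import Data.Nat.ListAction using (sum; product)
open import Data.Bool using (Bool; true; false)

-- Binary digits of n, least significant first (no leading zeros; 0 ↦ []).
-- Uses fuel (n itself suffices since n / 2 < n for n > 0).
bitsAux : ℕ → ℕ → List Bool
bitsAux zero    _ = []
bitsAux (suc f) zero = []
bitsAux (suc f) (suc m) with suc m % 2
... | zero = false ∷ bitsAux f (suc m / 2)
... | suc _ = true ∷ bitsAux f (suc m / 2)

bits : ℕ → List Bool
bits n = bitsAux n n

-- Lengths of all maximal runs of true (1's) in a bit list.
-- runsAux c bs : c is the length of the currently open run of 1's.
runsAux : ℕ → List Bool → List ℕ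
runsAux zero    []           = []
runsAux (suc c) []           = suc c ∷ []
runsAux c       (true ∷ bs)  = runsAux (suc c) bs
runsAux zero    (false ∷ bs) = runsAux zero bs
runsAux (suc c) (false ∷ bs) = suc c ∷ runsAux zero bs

runLengths : ℕ → List ℕ
runLengths n = runsAux 0 (bits n)

RLT : (ℕ → ℕ) → ℕ → ℕ
RLT S n = product (map S (runLengths n))

S : ℕ → ℕ
S 0 = 1
S 1 = 0
S 2 = 1
S (suc (suc (suc n))) = S (suc n) + S n

T : ℕ → ℕ
T n = sum (map (λ k → (((n + 7 * k) C (3 * n + k)) * (n C k)) % 2) (upTo (suc n)))

-- By Lucas' theorem, C(a, b) is odd iff every binary digit of b is at most the
-- corresponding digit of a. Splitting n and k into their last binary digit and the
-- rest, and carrying the overflow of the columns of n + 7k and 3n + k into the next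
-- digit, T n becomes the value of a finite automaton run on the bits of n whose
-- states are pairs of carries. From the initial state (0, 0) only fourteen states are
-- reachable, and on each of them the automaton computes 0 or a product of Padovan
-- numbers over the runs of 1's of the remaining bits; checking the transitions
-- between these values reduces to the recurrence S (c + 3) = S (c + 1) + S c.

module Submission where

open import Defs
open import Function using (_∘_)
open import Data.Bool using (Bool; true; false; _∧_; _xor_; if_then_else_)
open import Data.Bool.Properties using (∧-commutativeMonoid; ∧-identityʳ; ∧-zeroʳ; xor-identityʳ; xor-same)
open import Data.List using (List; []; _∷_; map; applyUpTo)
open import Data.Nat using (ℕ; zero; suc; _+_; _*_; _/_; _%_; _≤_; _<_; _≤ᵇ_; z≤n; s≤s)
open import Data.Nat.Properties
  using (+-identityʳ; +-comm; +-assoc; *-comm; *-distribʳ-+; *-identityʳ; +-commutativeSemigroup;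
         ≤-refl; ≤-trans; ≤-reflexive; ≤-pred; m<n⇒m<1+n; +-monoʳ-≤)
open import Data.Nat.DivMod using (m≡m%n+[m/n]*n; m%n<n; m/n<m; %-distribˡ-+; %-distribˡ-*)
open import Data.Nat.Combinatorics using (_C_; nCk+nC[k+1]≡[n+1]C[k+1])
open import Data.Nat.ListAction using (sum; product)
open import Data.Nat.Tactic.RingSolver using (solve-∀)
open import Algebra.Bundles using (CommutativeMonoid)
open import Algebra.Properties.CommutativeSemigroup +-commutativeSemigroup
  using () renaming (interchange to +-interchange)
open import Algebra.Properties.CommutativeSemigroup (CommutativeMonoid.commutativeSemigroup ∧-commutativeMonoid)
  using () renaming (interchange to ∧-interchange)
open import Relation.Binary.PropositionalEquality using (_≡_; refl; sym; trans; cong; cong₂; module ≡-Reasoning)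
open ≡-Reasoning

toℕ : Bool → ℕ
toℕ false = 0
toℕ true  = 1

toℕ-xor : ∀ p q → (toℕ p + toℕ q) % 2 ≡ toℕ (p xor q)
toℕ-xor false false = refl
toℕ-xor false true  = refl
toℕ-xor true  false = refl
toℕ-xor true  true  = refl

toℕ-∧ : ∀ p q → (toℕ p * toℕ q) % 2 ≡ toℕ (p ∧ q)
toℕ-∧ false q     = refl
toℕ-∧ true  false = refl
toℕ-∧ true  true  = refl

toℕ-∧-if : ∀ p q → toℕ (p ∧ q) ≡ (if p then toℕ q else 0)
toℕ-∧-if false q = refl
toℕ-∧-if true  q = refl

double : ℕ → ℕ
double zero    = zero
double (suc n) = suc (suc (double n))

double≡2* : ∀ n → double n ≡ 2 * n
double≡2* zero    = refl
double≡2* (suc n) = trans (cong (suc ∘ suc) (double≡2* n)) (lemma n)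
  where
  lemma : ∀ n → suc (suc (2 * n)) ≡ 2 * suc n
  lemma = solve-∀

double-+ : ∀ m n → double (m + n) ≡ double m + double n
double-+ zero    n = refl
double-+ (suc m) n = cong (suc ∘ suc) (double-+ m n)

double[n/2]+n%2≡n : ∀ n → double (n / 2) + n % 2 ≡ n
double[n/2]+n%2≡n n = begin
  double (n / 2) + n % 2 ≡⟨ cong (_+ n % 2) (double≡2* (n / 2)) ⟩
  2 * (n / 2) + n % 2    ≡⟨ cong (_+ n % 2) (*-comm 2 (n / 2)) ⟩
  n / 2 * 2 + n % 2      ≡⟨ +-comm (n / 2 * 2) (n % 2) ⟩
  n % 2 + n / 2 * 2      ≡⟨ m≡m%n+[m/n]*n n 2 ⟨
  n                      ∎

double-carry : ∀ m t → double m + t ≡ double (t / 2 + m) + t % 2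
double-carry m t = begin
  double m + t                          ≡⟨ cong (double m +_) (double[n/2]+n%2≡n t) ⟨
  double m + (double (t / 2) + t % 2)   ≡⟨ +-assoc (double m) (double (t / 2)) (t % 2) ⟨
  double m + double (t / 2) + t % 2     ≡⟨ cong (_+ t % 2) (+-comm (double m) (double (t / 2))) ⟩
  double (t / 2) + double m + t % 2     ≡⟨ cong (_+ t % 2) (double-+ (t / 2) m) ⟨
  double (t / 2 + m) + t % 2            ∎

infix 7 _C₂_
_C₂_ : ℕ → ℕ → Bool
n     C₂ zero  = true
zero  C₂ suc k = false
suc n C₂ suc k = n C₂ k xor n C₂ suc k

C%2≡C₂ : ∀ n k → (n C k) % 2 ≡ toℕ (n C₂ k)
C%2≡C₂ n       zero    = refl
C%2≡C₂ zero    (suc k) = refl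
C%2≡C₂ (suc n) (suc k) = begin
  (suc n C suc k) % 2                     ≡⟨ cong (_% 2) (nCk+nC[k+1]≡[n+1]C[k+1] n k) ⟨
  (n C k + n C suc k) % 2                 ≡⟨ %-distribˡ-+ (n C k) (n C suc k) 2 ⟩
  ((n C k) % 2 + (n C suc k) % 2) % 2     ≡⟨ cong₂ (λ x y → (x + y) % 2) (C%2≡C₂ n k) (C%2≡C₂ n (suc k)) ⟩
  (toℕ (n C₂ k) + toℕ (n C₂ suc k)) % 2   ≡⟨ toℕ-xor (n C₂ k) (n C₂ suc k) ⟩
  toℕ (suc n C₂ suc k)                    ∎

C*C%2≡C₂∧C₂ : ∀ a b c d → ((a C b) * (c C d)) % 2 ≡ toℕ (a C₂ b ∧ c C₂ d)
C*C%2≡C₂∧C₂ a b c d = begin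
  ((a C b) * (c C d)) % 2                  ≡⟨ %-distribˡ-* (a C b) (c C d) 2 ⟩
  ((a C b) % 2 * ((c C d) % 2)) % 2        ≡⟨ cong₂ (λ x y → (x * y) % 2) (C%2≡C₂ a b) (C%2≡C₂ c d) ⟩
  (toℕ (a C₂ b) * toℕ (c C₂ d)) % 2        ≡⟨ toℕ-∧ (a C₂ b) (c C₂ d) ⟩
  toℕ (a C₂ b ∧ c C₂ d)                    ∎

C₂-vanishes : ∀ {n k} → n < k → n C₂ k ≡ false
C₂-vanishes {zero}  {suc k} _         = refl
C₂-vanishes {suc n} {suc k} (s≤s n<k) =
  cong₂ _xor_ (C₂-vanishes n<k) (C₂-vanishes (m<n⇒m<1+n n<k))

mutual
  C₂-even-even : ∀ a c → double a C₂ double c ≡ a C₂ c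
  C₂-even-even a       zero    = refl
  C₂-even-even zero    (suc c) = refl
  C₂-even-even (suc a) (suc c)
    rewrite C₂-even-odd a c | xor-identityʳ (double a C₂ double c)
    = cong₂ _xor_ (C₂-even-even a c) (C₂-even-even a (suc c))

  C₂-even-odd : ∀ a c → double a C₂ suc (double c) ≡ false
  C₂-even-odd zero    c       = refl
  C₂-even-odd (suc a) zero    rewrite C₂-even-odd a zero = refl
  C₂-even-odd (suc a) (suc c)
    rewrite C₂-even-odd a c | C₂-even-odd a (suc c)
          | xor-identityʳ (double a C₂ double (suc c))
    = xor-same (double a C₂ double (suc c))

C₂-odd-even : ∀ a c → suc (double a) C₂ double c ≡ a C₂ c
C₂-odd-even a zero    = refl
C₂-odd-even a (suc c) rewrite C₂-even-odd a c = C₂-even-even a (suc c)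

C₂-odd-odd : ∀ a c → suc (double a) C₂ suc (double c) ≡ a C₂ c
C₂-odd-odd a c rewrite C₂-even-odd a c = trans (xor-identityʳ _) (C₂-even-even a c)

lucas : ∀ a c r s → r < 2 → s < 2 → (double a + r) C₂ (double c + s) ≡ (s ≤ᵇ r) ∧ a C₂ c
lucas a c 0 0 _ _
  rewrite +-identityʳ (double a) | +-identityʳ (double c) = C₂-even-even a c
lucas a c 0 1 _ _
  rewrite +-identityʳ (double a) | +-comm (double c) 1 = C₂-even-odd a c
lucas a c 1 0 _ _
  rewrite +-comm (double a) 1 | +-identityʳ (double c) = C₂-odd-even a c
lucas a c 1 1 _ _
  rewrite +-comm (double a) 1 | +-comm (double c) 1 = C₂-odd-odd a c
lucas a c (suc (suc r)) s (s≤s (s≤s ())) _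
lucas a c r (suc (suc s)) _ (s≤s (s≤s ()))

∑ : ℕ → (ℕ → ℕ) → ℕ
∑ zero    g = 0
∑ (suc n) g = g 0 + ∑ n (g ∘ suc)

∑-cong : ∀ n {g h : ℕ → ℕ} → (∀ k → g k ≡ h k) → ∑ n g ≡ ∑ n h
∑-cong zero    g≗h = refl
∑-cong (suc n) g≗h = cong₂ _+_ (g≗h 0) (∑-cong n (g≗h ∘ suc))

∑-zero : ∀ n {g : ℕ → ℕ} → (∀ k → g k ≡ 0) → ∑ n g ≡ 0
∑-zero zero    g≗0 = refl
∑-zero (suc n) g≗0 = cong₂ _+_ (g≗0 0) (∑-zero n (g≗0 ∘ suc))

∑-if : ∀ n p (g : ℕ → ℕ) → ∑ n (λ k → if p then g k else 0) ≡ (if p then ∑ n g else 0)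
∑-if n true  g = refl
∑-if n false g = ∑-zero n (λ _ → refl)

∑-vanishing-tail : ∀ {m n} (g : ℕ → ℕ) → m ≤ n → (∀ k → m ≤ k → g k ≡ 0) → ∑ n g ≡ ∑ m g
∑-vanishing-tail {zero}  {n}     g _         g≗0 = ∑-zero n (λ k → g≗0 k z≤n)
∑-vanishing-tail {suc m} {suc n} g (s≤s m≤n) g≗0 =
  cong (g 0 +_) (∑-vanishing-tail (g ∘ suc) m≤n (λ k → g≗0 (suc k) ∘ s≤s))

∑-double : ∀ n (g : ℕ → ℕ) → ∑ (double n) g ≡ ∑ n (g ∘ double) + ∑ n (g ∘ suc ∘ double)
∑-double zero    g = refl
∑-double (suc n) g = begin
  g 0 + (g 1 + ∑ (double n) (g ∘ suc ∘ suc))      ≡⟨ cong (λ x → g 0 + (g 1 + x)) (∑-double n (g ∘ suc ∘ suc)) ⟩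
  g 0 + (g 1 + (evens + odds))                    ≡⟨ +-assoc (g 0) (g 1) (evens + odds) ⟨
  g 0 + g 1 + (evens + odds)                      ≡⟨ +-interchange (g 0) (g 1) evens odds ⟩
  (g 0 + evens) + (g 1 + odds)                    ∎
  where
  evens = ∑ n (g ∘ suc ∘ suc ∘ double)
  odds  = ∑ n (g ∘ suc ∘ suc ∘ suc ∘ double)

sum-map-applyUpTo : ∀ n (g f : ℕ → ℕ) → sum (map g (applyUpTo f n)) ≡ ∑ n (g ∘ f)
sum-map-applyUpTo zero    g f = refl
sum-map-applyUpTo (suc n) g f = cong (g (f 0) +_) (sum-map-applyUpTo n g (f ∘ suc))

-- c₁ and c₂ are carries into the lower index 3n + k and the upper index n + 7k.
summand : ℕ → ℕ → ℕ → ℕ → ℕ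
summand n c₁ c₂ k = toℕ ((c₂ + (n + 7 * k)) C₂ (c₁ + (3 * n + k)) ∧ n C₂ k)

count : ℕ → ℕ → ℕ → ℕ
count n c₁ c₂ = ∑ (suc n) (summand n c₁ c₂)

lowerColumn upperColumn : ℕ → ℕ → ℕ → ℕ
lowerColumn b e c₁ = c₁ + (3 * b + e)
upperColumn b e c₂ = c₂ + (b + 7 * e)

-- Lucas' theorem at one binary digit: b of n, e of k, with incoming carries c₁ and c₂.
step : ℕ → ℕ → ℕ → ℕ → (ℕ → ℕ → ℕ) → ℕ
step b e c₁ c₂ h =
  if (lowerColumn b e c₁ % 2 ≤ᵇ upperColumn b e c₂ % 2) ∧ (e ≤ᵇ b)
  then h (lowerColumn b e c₁ / 2) (upperColumn b e c₂ / 2) else 0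

step-cong : ∀ b e c₁ c₂ {h h′ : ℕ → ℕ → ℕ} → (∀ x y → h x y ≡ h′ x y) →
            step b e c₁ c₂ h ≡ step b e c₁ c₂ h′
step-cong b e c₁ c₂ h≗h′ =
  cong (λ x → if (lowerColumn b e c₁ % 2 ≤ᵇ upperColumn b e c₂ % 2) ∧ (e ≤ᵇ b) then x else 0)
       (h≗h′ (lowerColumn b e c₁ / 2) (upperColumn b e c₂ / 2))

summand-vanishes : ∀ n c₁ c₂ k → n < k → summand n c₁ c₂ k ≡ 0
summand-vanishes n c₁ c₂ k n<k
  rewrite C₂-vanishes n<k | ∧-zeroʳ ((c₂ + (n + 7 * k)) C₂ (c₁ + (3 * n + k))) = refl

summand-digits : ∀ m b c₁ c₂ j e → b < 2 → e < 2 →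
  summand (double m + b) c₁ c₂ (double j + e) ≡ step b e c₁ c₂ (λ x y → summand m x y j)
summand-digits m b c₁ c₂ j e b<2 e<2 = begin
  toℕ ((c₂ + (n + 7 * k)) C₂ (c₁ + (3 * n + k)) ∧ n C₂ k)
    ≡⟨ cong₂ (λ x y → toℕ (x C₂ y ∧ n C₂ k)) upper lower ⟩
  toℕ ((double M₂ + t₂ % 2) C₂ (double M₁ + t₁ % 2) ∧ n C₂ k)
    ≡⟨ cong₂ (λ x y → toℕ (x ∧ y)) (lucas M₂ M₁ (t₂ % 2) (t₁ % 2) (m%n<n t₂ 2) (m%n<n t₁ 2))
                                   (lucas m j b e b<2 e<2) ⟩
  toℕ (((t₁ % 2 ≤ᵇ t₂ % 2) ∧ M₂ C₂ M₁) ∧ ((e ≤ᵇ b) ∧ m C₂ j))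
    ≡⟨ cong toℕ (∧-interchange (t₁ % 2 ≤ᵇ t₂ % 2) (M₂ C₂ M₁) (e ≤ᵇ b) (m C₂ j)) ⟩
  toℕ (((t₁ % 2 ≤ᵇ t₂ % 2) ∧ (e ≤ᵇ b)) ∧ (M₂ C₂ M₁ ∧ m C₂ j))
    ≡⟨ toℕ-∧-if ((t₁ % 2 ≤ᵇ t₂ % 2) ∧ (e ≤ᵇ b)) (M₂ C₂ M₁ ∧ m C₂ j) ⟩
  step b e c₁ c₂ (λ x y → summand m x y j) ∎
  where
  n  = double m + b
  k  = double j + e
  t₁ = lowerColumn b e c₁
  t₂ = upperColumn b e c₂
  M₁ = t₁ / 2 + (3 * m + j)
  M₂ = t₂ / 2 + (m + 7 * j)

  upper-index : c₂ + (n + 7 * k) ≡ double (m + 7 * j) + t₂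
  upper-index rewrite double≡2* m | double≡2* j | double≡2* (m + 7 * j) = identity c₂ m b j e
    where
    identity : ∀ c₂ m b j e → c₂ + (2 * m + b + 7 * (2 * j + e)) ≡ 2 * (m + 7 * j) + (c₂ + (b + 7 * e))
    identity = solve-∀

  lower-index : c₁ + (3 * n + k) ≡ double (3 * m + j) + t₁
  lower-index rewrite double≡2* m | double≡2* j | double≡2* (3 * m + j) = identity c₁ m b j e
    where
    identity : ∀ c₁ m b j e → c₁ + (3 * (2 * m + b) + (2 * j + e)) ≡ 2 * (3 * m + j) + (c₁ + (3 * b + e))
    identity = solve-∀

  upper : c₂ + (n + 7 * k) ≡ double M₂ + t₂ % 2
  upper = trans upper-index (double-carry (m + 7 * j) t₂)

  lower : c₁ + (3 * n + k) ≡ double M₁ + t₁ % 2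
  lower = trans lower-index (double-carry (3 * m + j) t₁)

-- Only k ≤ n contributes, so the range k < n + 1 may be widened to k < 2m + 2.
count-double : ∀ m b c₁ c₂ → b < 2 →
  count (double m + b) c₁ c₂ ≡ step b 0 c₁ c₂ (count m) + step b 1 c₁ c₂ (count m)
count-double m b c₁ c₂ b<2 = begin
  ∑ (suc n) g                                       ≡⟨ ∑-vanishing-tail g n<double[1+m] (summand-vanishes n c₁ c₂) ⟨
  ∑ (double (suc m)) g                              ≡⟨ ∑-double (suc m) g ⟩
  ∑ (suc m) (g ∘ double) + ∑ (suc m) (g ∘ suc ∘ double)
    ≡⟨ cong₂ _+_ (digitSum 0 (s≤s z≤n) (λ j → sym (+-identityʳ (double j))))
                 (digitSum 1 (s≤s (s≤s z≤n)) (λ j → +-comm 1 (double j))) ⟩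
  step b 0 c₁ c₂ (count m) + step b 1 c₁ c₂ (count m) ∎
  where
  n = double m + b
  g = summand n c₁ c₂

  n<double[1+m] : suc n ≤ double (suc m)
  n<double[1+m] = s≤s (≤-trans (+-monoʳ-≤ (double m) (≤-pred b<2)) (≤-reflexive (+-comm (double m) 1)))

  digitSum : ∀ e → e < 2 → {k : ℕ → ℕ} → (∀ j → k j ≡ double j + e) →
             ∑ (suc m) (g ∘ k) ≡ step b e c₁ c₂ (count m)
  digitSum e e<2 {k} k≡ = begin
    ∑ (suc m) (g ∘ k)
      ≡⟨ ∑-cong (suc m) (λ j → trans (cong g (k≡ j)) (summand-digits m b c₁ c₂ j e b<2 e<2)) ⟩
    ∑ (suc m) (λ j → step b e c₁ c₂ (λ x y → summand m x y j))
      ≡⟨ ∑-if (suc m) ((lowerColumn b e c₁ % 2 ≤ᵇ upperColumn b e c₂ % 2) ∧ (e ≤ᵇ b))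
              (summand m (lowerColumn b e c₁ / 2) (upperColumn b e c₂ / 2)) ⟩
    step b e c₁ c₂ (count m) ∎

fromBits : List Bool → ℕ
fromBits []       = 0
fromBits (b ∷ bs) = double (fromBits bs) + toℕ b

fromBits-∷ : ∀ {b n} bs → fromBits bs ≡ n / 2 → toℕ b ≡ n % 2 → fromBits (b ∷ bs) ≡ n
fromBits-∷ {b} {n} bs high low = begin
  double (fromBits bs) + toℕ b ≡⟨ cong₂ (λ x y → double x + y) high low ⟩
  double (n / 2) + n % 2       ≡⟨ double[n/2]+n%2≡n n ⟩
  n                            ∎

fromBits-bitsAux : ∀ fuel n → n ≤ fuel → fromBits (bitsAux fuel n) ≡ n
fromBits-bitsAux zero       zero    _ = refl
fromBits-bitsAux (suc fuel) zero    _ = refl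
fromBits-bitsAux (suc fuel) (suc m) (s≤s m≤fuel)
  with suc m % 2 in eq | m%n<n (suc m) 2
     | fromBits-bitsAux fuel (suc m / 2) (≤-pred (≤-trans (m/n<m (suc m) 2 (s≤s (s≤s z≤n))) (s≤s m≤fuel)))
... | zero        | _             | high = fromBits-∷ (bitsAux fuel (suc m / 2)) high (sym eq)
... | suc zero    | _             | high = fromBits-∷ (bitsAux fuel (suc m / 2)) high (sym eq)
... | suc (suc _) | s≤s (s≤s ()) | _

fromBits-bits : ∀ n → fromBits (bits n) ≡ n
fromBits-bits n = fromBits-bitsAux n n ≤-refl

toℕ<2 : ∀ b → toℕ b < 2
toℕ<2 false = s≤s z≤n
toℕ<2 true  = s≤s (s≤s z≤n)

carryCount : List Bool → ℕ → ℕ → ℕ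
carryCount []       c₁ c₂ = toℕ (c₂ C₂ c₁)
carryCount (b ∷ bs) c₁ c₂ = step (toℕ b) 0 c₁ c₂ (carryCount bs) + step (toℕ b) 1 c₁ c₂ (carryCount bs)

count≡carryCount : ∀ bs c₁ c₂ → count (fromBits bs) c₁ c₂ ≡ carryCount bs c₁ c₂
count≡carryCount [] c₁ c₂
  rewrite +-identityʳ c₁ | +-identityʳ c₂ | ∧-identityʳ (c₂ C₂ c₁) = +-identityʳ (toℕ (c₂ C₂ c₁))
count≡carryCount (b ∷ bs) c₁ c₂ = trans (count-double (fromBits bs) (toℕ b) c₁ c₂ (toℕ<2 b))
  (cong₂ _+_ (step-cong (toℕ b) 0 c₁ c₂ (count≡carryCount bs))
             (step-cong (toℕ b) 1 c₁ c₂ (count≡carryCount bs)))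

runProduct : ℕ → List Bool → ℕ
runProduct c bs = product (map S (runsAux c bs))

afterLeadingOne : List Bool → ℕ
afterLeadingOne []           = 0
afterLeadingOne (false ∷ bs) = 0
afterLeadingOne (true ∷ bs)  = runProduct 0 bs

runProduct-false : ∀ c bs → runProduct c (false ∷ bs) ≡ S c * runProduct 0 bs
runProduct-false zero    bs = sym (+-identityʳ (runProduct 0 bs))
runProduct-false (suc c) bs = refl

runProduct-padovan : ∀ c bs → runProduct (3 + c) bs ≡ runProduct (1 + c) bs + runProduct c bs
runProduct-padovan zero    []           = refl
runProduct-padovan (suc c) []           =
  trans (*-identityʳ (S (4 + c)))
        (sym (cong₂ _+_ (*-identityʳ (S (2 + c))) (*-identityʳ (S (1 + c)))))
runProduct-padovan zero    (true ∷ bs)  = runProduct-padovan 1 bs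
runProduct-padovan (suc c) (true ∷ bs)  = runProduct-padovan (2 + c) bs
runProduct-padovan c       (false ∷ bs) =
  trans (*-distribʳ-+ (runProduct 0 bs) (S (1 + c)) (S c))
        (cong (S (1 + c) * runProduct 0 bs +_) (sym (runProduct-false c bs)))

runProduct-2 : ∀ bs → runProduct 2 bs ≡ runProduct 0 bs + afterLeadingOne bs
runProduct-2 []           = refl
runProduct-2 (false ∷ bs) = refl
runProduct-2 (true ∷ bs)  = runProduct-padovan 0 bs

-- The fourteen carry pairs reachable from (0, 0).
mutual
  carryCount[1,0] : ∀ bs → carryCount bs 1 0 ≡ 0
  carryCount[1,0] []           = refl
  carryCount[1,0] (false ∷ bs) = refl
  carryCount[1,0] (true ∷ bs)  = cong (_+ 0) (carryCount[2,0] bs)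

  carryCount[2,0] : ∀ bs → carryCount bs 2 0 ≡ 0
  carryCount[2,0] []           = refl
  carryCount[2,0] (false ∷ bs) = cong (_+ 0) (carryCount[1,0] bs)
  carryCount[2,0] (true ∷ bs)  = cong₂ _+_ (carryCount[2,0] bs) (carryCount[3,4] bs)

  carryCount[3,4] : ∀ bs → carryCount bs 3 4 ≡ 0
  carryCount[3,4] []           = refl
  carryCount[3,4] (false ∷ bs) = refl
  carryCount[3,4] (true ∷ bs)  = cong (_+ 0) (carryCount[3,2] bs)

  carryCount[3,2] : ∀ bs → carryCount bs 3 2 ≡ 0
  carryCount[3,2] []           = refl
  carryCount[3,2] (false ∷ bs) = refl
  carryCount[3,2] (true ∷ bs)  = cong (_+ 0) (carryCount[3,1] bs)

  carryCount[3,1] : ∀ bs → carryCount bs 3 1 ≡ 0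
  carryCount[3,1] []           = refl
  carryCount[3,1] (false ∷ bs) = cong (_+ 0) (carryCount[1,0] bs)
  carryCount[3,1] (true ∷ bs)  = cong₂ _+_ (carryCount[3,1] bs) (carryCount[3,4] bs)

  carryCount[2,1] : ∀ bs → carryCount bs 2 1 ≡ 0
  carryCount[2,1] []           = refl
  carryCount[2,1] (false ∷ bs) = cong (_+ 0) (carryCount[1,0] bs)
  carryCount[2,1] (true ∷ bs)  = cong (0 +_) (carryCount[3,4] bs)

  carryCount[1,2] : ∀ bs → carryCount bs 1 2 ≡ 0
  carryCount[1,2] []           = refl
  carryCount[1,2] (false ∷ bs) = refl
  carryCount[1,2] (true ∷ bs)  = cong (_+ 0) (carryCount[2,1] bs)

  carryCount[0,0] : ∀ bs → carryCount bs 0 0 ≡ runProduct 0 bs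
  carryCount[0,0] []           = refl
  carryCount[0,0] (false ∷ bs) = trans (cong (_+ 0) (carryCount[0,0] bs)) (+-identityʳ _)
  carryCount[0,0] (true ∷ bs)  = cong₂ _+_ (carryCount[1,0] bs) (carryCount[2,4] bs)

  carryCount[1,1] : ∀ bs → carryCount bs 1 1 ≡ runProduct 0 bs
  carryCount[1,1] []           = refl
  carryCount[1,1] (false ∷ bs) = trans (cong (_+ 0) (carryCount[0,0] bs)) (+-identityʳ _)
  carryCount[1,1] (true ∷ bs)  = cong₂ _+_ (carryCount[2,1] bs) (carryCount[2,4] bs)

  carryCount[2,2] : ∀ bs → carryCount bs 2 2 ≡ runProduct 0 bs
  carryCount[2,2] []           = refl
  carryCount[2,2] (false ∷ bs) = trans (cong (_+ 0) (carryCount[1,1] bs)) (+-identityʳ _)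
  carryCount[2,2] (true ∷ bs)  = cong₂ _+_ (carryCount[2,1] bs) (carryCount[3,5] bs)

  carryCount[3,3] : ∀ bs → carryCount bs 3 3 ≡ runProduct 0 bs
  carryCount[3,3] []           = refl
  carryCount[3,3] (false ∷ bs) = trans (cong (_+ 0) (carryCount[1,1] bs)) (+-identityʳ _)
  carryCount[3,3] (true ∷ bs)  = cong₂ _+_ (carryCount[3,2] bs) (carryCount[3,5] bs)

  carryCount[2,4] : ∀ bs → carryCount bs 2 4 ≡ runProduct 1 bs
  carryCount[2,4] []           = refl
  carryCount[2,4] (false ∷ bs) = cong (_+ 0) (carryCount[1,2] bs)
  carryCount[2,4] (true ∷ bs)  =
    trans (cong₂ _+_ (carryCount[2,2] bs) (carryCount[3,6] bs)) (sym (runProduct-2 bs))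

  carryCount[3,5] : ∀ bs → carryCount bs 3 5 ≡ runProduct 1 bs
  carryCount[3,5] []           = refl
  carryCount[3,5] (false ∷ bs) = cong (_+ 0) (carryCount[1,2] bs)
  carryCount[3,5] (true ∷ bs)  =
    trans (cong₂ _+_ (carryCount[3,3] bs) (carryCount[3,6] bs)) (sym (runProduct-2 bs))

  carryCount[3,6] : ∀ bs → carryCount bs 3 6 ≡ afterLeadingOne bs
  carryCount[3,6] []           = refl
  carryCount[3,6] (false ∷ bs) = refl
  carryCount[3,6] (true ∷ bs)  = trans (cong (_+ 0) (carryCount[3,3] bs)) (+-identityʳ _)

T≡count : ∀ n → T n ≡ count n 0 0
T≡count n = trans (sum-map-applyUpTo (suc n) _ (λ k → k))
                  (∑-cong (suc n) (λ k → C*C%2≡C₂∧C₂ (n + 7 * k) (3 * n + k) n k))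

theorem13 : ∀ (n : ℕ) → T n ≡ RLT S n
theorem13 n = begin
  T n                           ≡⟨ T≡count n ⟩
  count n 0 0                   ≡⟨ cong (λ m → count m 0 0) (fromBits-bits n) ⟨
  count (fromBits (bits n)) 0 0 ≡⟨ count≡carryCount (bits n) 0 0 ⟩
  carryCount (bits n) 0 0       ≡⟨ carryCount[0,0] (bits n) ⟩
  RLT S n                       ∎
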